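{- Let $a,b$ be integers with $1<a<b$ and $\gcd(a,b)=1$. Let $A=(a_1,\dots,a_k)$ be a pinwheel packing instance with $a_1\le a_2\le\dots\le a_k$ and $(a_1,a_2)=(a,b)$. If $\sum_{i=1}^k\frac{1}{a_i}>1-\frac{1}{ab^2}$, then $A$ is unschedulable.
   Context: A pinwheel packing instance is a finite list $(a_1,\dots,a_k)$ of positive integers. A schedule $f:\mathbb{N}\to\{1,\dots,k\}$ assigns each day to one job. It is valid if for every $i$, every block of $a_i$ consecutive days contains at least one day assigned to job $i$. The instance is schedulable if a valid schedule exists. -}

module Defs where

open import Data.Nat using (ℕ; zero; suc; _+_; _*_; _<_; _≤_)
open import Data.Fin using (Fin; toℕ)
open import Data.Product using (Σ; ∃; _×_)
open import Data.Integer using (+_)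
open import Data.Rational using (ℚ; _/_; 0ℚ; _+_)
open import Relation.Binary.PropositionalEquality using (_≡_)

-- A pinwheel packing instance with k jobs: a list (a_1,...,a_k) of positive integers,
-- represented as a function Fin k → ℕ (index 0 is job 1), positivity stated separately.

Schedule : ℕ → Set
Schedule k = ℕ → Fin k

Valid : {k : ℕ} → (Fin k → ℕ) → Schedule k → Set
Valid {k} a f = ∀ (i : Fin k) (t : ℕ) → ∃ λ d → d < a i × f (t Data.Nat.+ d) ≡ i

Schedulable : {k : ℕ} → (Fin k → ℕ) → Set
Schedulable {k} a = Σ (Schedule k) λ f → Valid a f

-- 1/n as a rational (only used for n ≥ 1; the value at 0 is an irrelevant default)
recip : ℕ → ℚ
recip zero = 0ℚ
recip (suc n) = (+ 1) / suc n

recipSum : {k : ℕ} → (Fin k → ℕ) → ℚ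
recipSum {zero} a = 0ℚ
recipSum {suc k} a = recip (a Data.Fin.zero) Data.Rational.+ recipSum (λ i → a (Data.Fin.suc i))

-- For a job of period p, each occurrence t is followed by the next one at most p days later;
-- call the shortfall the slack at t. Over n days the job then occurs at least
-- (n + total slack)/p - 1 times. Starting from an occurrence x of the job with period b,
-- within ab days either that job accumulates slack, or it occurs at x, x + b, ..., x + ab;
-- in the latter case the job with period a has slack too, for otherwise it occurs at
-- x + w + ia for all ia ≤ ab - w, and as gcd(a,b) = 1 one of these days is some x + jb.
-- Hence n days carry weighted slack b²·D₁ + ab·D₂ ≥ n - ab, which raises the joint
-- frequency of the two jobs from 1/a + 1/b to 1/a + 1/b + 1/(ab²). With the frequencies
-- 1/aᵢ of the other jobs this exceeds 1, although every day hosts only one job; the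
-- contradiction is made exact over N = M·ab·∏ᵢ aᵢ days for a large M.

module Submission where

open import Defs
open import Data.Nat using (ℕ; suc; _*_; _<_; _≤_)
open import Data.Nat.GCD using (gcd)
open import Data.Fin using (Fin; zero; suc; toℕ)
open import Data.Rational using (_-_; 1ℚ; _>_)
open import Relation.Binary.PropositionalEquality using (_≡_)
open import Relation.Nullary using (¬_)

open import Data.Nat using (zero; _+_; _∸_; _≤?_; z≤n; s≤s; s≤s⁻¹; z<s; pred; NonZero; >-nonZero; ≢-nonZero; _%_; _/_)
open import Data.Nat.Properties
open import Data.Nat.DivMod using (m≡m%n+[m/n]*n; [m+kn]%n≡m%n; m<n⇒m%n≡m; m%n<n; m%n%n≡m%n; %-distribˡ-*)
open import Data.Nat.GCD using (module Bézout)
open import Data.Nat.Coprimality using (Coprime; coprime-Bézout; gcd≡1⇒coprime)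
open import Data.Nat.Induction using (<-wellFounded)
open import Data.Nat.Tactic.RingSolver using (solve-∀)
import Data.Fin as Fin
open import Data.Bool using (Bool; true; false; if_then_else_)
open import Data.Product using (∃; _×_; _,_)
open import Data.Empty using (⊥; ⊥-elim)
open import Data.Integer as ℤ using (+_; -[1+_])
import Data.Integer.Properties as ℤ
open import Data.Rational as ℚ using (toℚᵘ)
import Data.Rational.Properties as ℚ
open import Data.Rational.Unnormalised as ℚᵘ using (mkℚᵘ; 1ℚᵘ; _≃_; *<*)
import Data.Rational.Unnormalised.Properties as ℚᵘ
open import Algebra.Properties.CommutativeMonoid.Sum +-0-commutativeMonoid using (sum; ∑-distrib-+; sum-replicate-zero)
open import Function using (_∘_)
open import Induction.WellFounded using (Acc; acc)
open import Relation.Nullary using (does; yes; no; contradiction)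
open import Relation.Nullary.Decidable using (dec-true)
open import Relation.Binary.PropositionalEquality

indicator : (ℕ → Bool) → ℕ → ℕ
indicator g t = if g t then 1 else 0

count : (ℕ → Bool) → ℕ → ℕ → ℕ
count g s zero    = zero
count g s (suc n) = indicator g s + count g (suc s) n

module BoundedGaps (g : ℕ → Bool) (p : ℕ)
                   (gaps : ∀ t → ∃ λ d → d < p × g (t + d) ≡ true) where

  private
    g-cong : ∀ {x y b} → x ≡ y → g x ≡ b → g y ≡ b
    g-cong refl h = h

    hit≢miss : ∀ {x} → g x ≡ true → g x ≡ false → ⊥
    hit≢miss h m with trans (sym h) m
    ... | ()

  firstHit : ℕ → ℕ → ℕ
  firstHit s zero    = zero
  firstHit s (suc n) = if g s then zero else suc (firstHit (suc s) n)

  firstHit-≤ : ∀ s n d → g (s + d) ≡ true → firstHit s n ≤ d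
  firstHit-≤ s zero d h = z≤n
  firstHit-≤ s (suc n) d h with g s in eq
  ... | true = z≤n
  firstHit-≤ s (suc n) zero    h | false = contradiction eq (hit≢miss (g-cong (+-identityʳ s) h))
  firstHit-≤ s (suc n) (suc d) h | false = s≤s (firstHit-≤ (suc s) n d (g-cong (+-suc s d) h))

  firstHit-hit : ∀ s n → firstHit s n < n → g (s + firstHit s n) ≡ true
  firstHit-hit s (suc n) lt with g s in eq
  ... | true  = g-cong (sym (+-identityʳ s)) eq
  ... | false = g-cong (sym (+-suc s _)) (firstHit-hit (suc s) n (s≤s⁻¹ lt))

  firstHit-miss : ∀ s n e → e < firstHit s n → g (s + e) ≡ false
  firstHit-miss s (suc n) e lt with g s in eq
  firstHit-miss s (suc n) zero    lt       | false = g-cong (sym (+-identityʳ s)) eq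
  firstHit-miss s (suc n) (suc e) (s≤s lt) | false = g-cong (sym (+-suc s e)) (firstHit-miss (suc s) n e lt)

  wait : ℕ → ℕ
  wait t = firstHit t p

  wait-≤ : ∀ t d → g (t + d) ≡ true → wait t ≤ d
  wait-≤ t = firstHit-≤ t p

  wait<p : ∀ t → wait t < p
  wait<p t with gaps t
  ... | d , d<p , h = ≤-<-trans (wait-≤ t d h) d<p

  0<p : 0 < p
  0<p = ≤-<-trans z≤n (wait<p 0)

  wait-hit : ∀ t → g (t + wait t) ≡ true
  wait-hit t = firstHit-hit t p (wait<p t)

  wait-miss : ∀ t e → e < wait t → g (t + e) ≡ false
  wait-miss t = firstHit-miss t p

  wait-at-hit : ∀ t → g t ≡ true → wait t ≡ 0
  wait-at-hit t h = n≤0⇒n≡0 (wait-≤ t 0 (g-cong (sym (+-identityʳ t)) h))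

  wait-at-miss : ∀ t → g t ≡ false → wait t ≡ suc (wait (suc t))
  wait-at-miss t miss = ≤-antisym upper lower
    where
    upper : wait t ≤ suc (wait (suc t))
    upper = wait-≤ t _ (g-cong (sym (+-suc t _)) (wait-hit (suc t)))
    lower : suc (wait (suc t)) ≤ wait t
    lower with wait t | wait-hit t
    ... | zero  | h = contradiction miss (hit≢miss (g-cong (+-identityʳ t) h))
    ... | suc w | h = s≤s (wait-≤ (suc t) w (g-cong (+-suc t w) h))

  -- At a hit t the next hit is t + suc (wait (suc t)), at most p days later;
  -- slack t is how much earlier than that deadline it comes.
  slack : ℕ → ℕ
  slack t = if g t then p ∸ suc (wait (suc t)) else 0

  totalSlack : ℕ → ℕ → ℕ
  totalSlack s zero    = 0
  totalSlack s (suc n) = slack s + totalSlack (suc s) n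

  count-step : ∀ t → p * indicator g t + wait t ≡ suc (slack t + wait (suc t))
  count-step t with g t in eq
  ... | true  = begin
    p * 1 + wait t                    ≡⟨ cong₂ _+_ (*-identityʳ p) (wait-at-hit t eq) ⟩
    p + 0                             ≡⟨ +-identityʳ p ⟩
    p                                 ≡⟨ sym (m∸n+n≡m (wait<p (suc t))) ⟩
    p ∸ suc w + suc w                 ≡⟨ +-suc (p ∸ suc w) w ⟩
    suc (p ∸ suc w + w)               ∎
    where open ≡-Reasoning
          w = wait (suc t)
  ... | false = cong₂ _+_ (*-zeroʳ p) (wait-at-miss t eq)

  count-telescope : ∀ s n → p * count g s n + wait s ≡ n + totalSlack s n + wait (s + n)
  count-telescope s zero rewrite *-zeroʳ p | +-identityʳ s = refl
  count-telescope s (suc n) = begin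
    p * (indicator g s + c) + wait s               ≡⟨ expand p (indicator g s) c (wait s) ⟩
    (p * indicator g s + wait s) + p * c           ≡⟨ cong (_+ p * c) (count-step s) ⟩
    suc (slack s + wait (suc s)) + p * c           ≡⟨ regroup (slack s) (wait (suc s)) (p * c) ⟩
    suc (slack s + (p * c + wait (suc s)))         ≡⟨ cong (λ x → suc (slack s + x)) (count-telescope (suc s) n) ⟩
    suc (slack s + (n + D + wait (suc s + n)))     ≡⟨ collect (slack s) n D (wait (suc s + n)) ⟩
    suc n + (slack s + D) + wait (suc s + n)       ≡⟨ cong (λ x → suc n + (slack s + D) + wait x) (sym (+-suc s n)) ⟩
    suc n + (slack s + D) + wait (s + suc n)       ∎
    where
    open ≡-Reasoning
    c = count g (suc s) n
    D = totalSlack (suc s) n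
    expand : ∀ p h c w → p * (h + c) + w ≡ (p * h + w) + p * c
    expand = solve-∀
    regroup : ∀ x w y → suc (x + w) + y ≡ suc (x + (y + w))
    regroup = solve-∀
    collect : ∀ x n D w → suc (x + (n + D + w)) ≡ suc n + (x + D) + w
    collect = solve-∀

  count-lower-bound : ∀ s n → n + totalSlack s n ≤ p * count g s n + p
  count-lower-bound s n = begin
    n + totalSlack s n                       ≤⟨ m≤m+n _ _ ⟩
    n + totalSlack s n + wait (s + n)        ≡⟨ count-telescope s n ⟨
    p * count g s n + wait s                 ≤⟨ +-monoʳ-≤ (p * count g s n) (<⇒≤ (wait<p s)) ⟩
    p * count g s n + p                      ∎
    where open ≤-Reasoning

  totalSlack-+ : ∀ s m n → totalSlack s (m + n) ≡ totalSlack s m + totalSlack (s + m) n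
  totalSlack-+ s zero n rewrite +-identityʳ s = refl
  totalSlack-+ s (suc m) n rewrite totalSlack-+ (suc s) m n | +-suc s m =
    sym (+-assoc (slack s) _ _)

  totalSlack≡0-prefix : ∀ s n k → totalSlack s n ≡ 0 → k ≤ n → totalSlack s k ≡ 0
  totalSlack≡0-prefix s n k none k≤n = m+n≡0⇒m≡0 (totalSlack s k) (begin
    totalSlack s k + totalSlack (s + k) (n ∸ k)  ≡⟨ totalSlack-+ s k (n ∸ k) ⟨
    totalSlack s (k + (n ∸ k))                   ≡⟨ cong (totalSlack s) (m+[n∸m]≡n k≤n) ⟩
    totalSlack s n                               ≡⟨ none ⟩
    0                                            ∎)
    where open ≡-Reasoning

  totalSlack≡0-suffix : ∀ s d k → totalSlack s (d + k) ≡ 0 → totalSlack (s + d) k ≡ 0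
  totalSlack≡0-suffix s d k none = m+n≡0⇒n≡0 (totalSlack s d) (trans (sym (totalSlack-+ s d k)) none)

  slack-at-hit : ∀ t → g t ≡ true → slack t ≡ p ∸ suc (wait (suc t))
  slack-at-hit t h with g t
  ... | true  = refl
  ... | false = contradiction h λ ()

  slack-at-miss : ∀ t → g t ≡ false → slack t ≡ 0
  slack-at-miss t miss with g t
  ... | false = refl
  ... | true  = contradiction miss λ ()

  head-slack≡0 : ∀ s n → totalSlack s n ≡ 0 → 0 < n → slack s ≡ 0
  head-slack≡0 s (suc n) none _ = m+n≡0⇒m≡0 (slack s) none

  totalSlack-no-hits : ∀ s n → (∀ e → e < n → g (s + e) ≡ false) → totalSlack s n ≡ 0
  totalSlack-no-hits s zero    none = refl
  totalSlack-no-hits s (suc n) none =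
    cong₂ _+_ (slack-at-miss s (g-cong (+-identityʳ s) (none 0 z<s)))
              (totalSlack-no-hits (suc s) n (λ e e<n → g-cong (+-suc s e) (none (suc e) (s≤s e<n))))

  totalSlack-after-quiet : ∀ z n → totalSlack z p ≡ 0 → totalSlack z (p + n) ≡ totalSlack (z + p) n
  totalSlack-after-quiet z n quiet = trans (totalSlack-+ z p n) (cong (_+ totalSlack (z + p) n) quiet)

  zero-slack-step : ∀ z → g z ≡ true → slack z ≡ 0 → g (z + p) ≡ true × totalSlack z p ≡ 0
  zero-slack-step z h none = subst (λ q → g (z + q) ≡ true) period next , subst (λ q → totalSlack z q ≡ 0) period quiet
    where
    w = wait (suc z)
    period : suc w ≡ p
    period = ≤-antisym (wait<p (suc z)) (m∸n≡0⇒m≤n (trans (sym (slack-at-hit z h)) none))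
    next : g (z + suc w) ≡ true
    next = g-cong (sym (+-suc z w)) (wait-hit (suc z))
    quiet : totalSlack z (suc w) ≡ 0
    quiet = cong₂ _+_ none (totalSlack-no-hits (suc z) w (wait-miss (suc z)))

  zero-slack-run : ∀ j z → g z ≡ true → totalSlack z (j * p) ≡ 0 → g (z + j * p) ≡ true
  zero-slack-run zero    z h _    = g-cong (sym (+-identityʳ z)) h
  zero-slack-run (suc j) z h none
    with zero-slack-step z h (head-slack≡0 z (p + j * p) none (≤-trans 0<p (m≤m+n p (j * p))))
  ... | next , quiet = g-cong (+-assoc z p (j * p))
    (zero-slack-run j (z + p) next (trans (sym (totalSlack-after-quiet z (j * p) quiet)) none))

  slack-witness : ∀ j z → g z ≡ true → 0 < totalSlack z (j * p) →
    ∃ λ ℓ → 0 < ℓ × ℓ ≤ j * p × g (z + ℓ) ≡ true × 0 < totalSlack z ℓ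
  slack-witness (suc j) z h pos with slack z ≟ 0
  ... | no slack≢0 =
    suc w , z<s , ≤-trans (wait<p (suc z)) (m≤m+n p (j * p)) ,
    g-cong (sym (+-suc z w)) (wait-hit (suc z)) , ≤-trans (n≢0⇒n>0 slack≢0) (m≤m+n (slack z) _)
    where w = wait (suc z)
  ... | yes none with zero-slack-step z h none
  ... | next , quiet with slack-witness j (z + p) next (subst (0 <_) (totalSlack-after-quiet z (j * p) quiet) pos)
  ... | ℓ , 0<ℓ , ℓ≤jp , hitℓ , posℓ =
    p + ℓ , ≤-trans 0<ℓ (m≤n+m ℓ p) , +-monoʳ-≤ p ℓ≤jp , g-cong (+-assoc z p ℓ) hitℓ ,
    subst (0 <_) (sym (totalSlack-after-quiet z ℓ quiet)) posℓ

mod-inverse : ∀ a b .{{_ : NonZero a}} → 1 < a → Coprime a b → ∃ λ u → (u * b) % a ≡ 1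
mod-inverse a@(suc a′) b 1<a coprime with coprime-Bézout coprime
... | Bézout.-+ x y eq = y , (begin
  (y * b) % a      ≡⟨ cong (_% a) eq ⟨
  (1 + x * a) % a  ≡⟨ [m+kn]%n≡m%n 1 x a ⟩
  1 % a            ≡⟨ m<n⇒m%n≡m 1<a ⟩
  1                ∎)
  where open ≡-Reasoning
... | Bézout.+- x y eq = y * a′ , (begin
  (y * a′ * b) % a               ≡⟨ [m+kn]%n≡m%n (y * a′ * b) 1 a ⟨
  (y * a′ * b + 1 * a) % a       ≡⟨ cong (_% a) (regroup y a′ b) ⟩
  (a′ * (1 + y * b) + 1) % a     ≡⟨ cong (λ z → (a′ * z + 1) % a) eq ⟩
  (a′ * (x * a) + 1) % a         ≡⟨ cong (_% a) (reorder a′ x) ⟩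
  (1 + a′ * x * a) % a           ≡⟨ [m+kn]%n≡m%n 1 (a′ * x) a ⟩
  1 % a                          ≡⟨ m<n⇒m%n≡m 1<a ⟩
  1                              ∎)
  where
  open ≡-Reasoning
  regroup : ∀ y a′ b → y * a′ * b + 1 * suc a′ ≡ a′ * (1 + y * b) + 1
  regroup = solve-∀
  reorder : ∀ a′ x → a′ * (x * suc a′) + 1 ≡ 1 + a′ * x * suc a′
  reorder = solve-∀

solve-congruence : ∀ a b u w .{{_ : NonZero a}} → (u * b) % a ≡ 1 → w < a →
  ∃ λ j → ∃ λ i → j < a × j * b ≡ w + i * a
solve-congruence a b u w inverse w<a = j , (j * b) / a , m%n<n (w * u) a , (begin
  j * b                          ≡⟨ m≡m%n+[m/n]*n (j * b) a ⟩
  (j * b) % a + (j * b) / a * a  ≡⟨ cong (_+ (j * b) / a * a) residue ⟩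
  w + (j * b) / a * a            ∎)
  where
  open ≡-Reasoning
  j = (w * u) % a
  residue : (j * b) % a ≡ w
  residue = begin
    (j * b) % a                      ≡⟨ %-distribˡ-* j b a ⟩
    (j % a * (b % a)) % a            ≡⟨ cong (λ z → (z * (b % a)) % a) (m%n%n≡m%n (w * u) a) ⟩
    (j * (b % a)) % a                ≡⟨ %-distribˡ-* (w * u) b a ⟨
    (w * u * b) % a                  ≡⟨ cong (_% a) (*-assoc w u b) ⟩
    (w * (u * b)) % a                ≡⟨ %-distribˡ-* w (u * b) a ⟩
    (w % a * ((u * b) % a)) % a      ≡⟨ cong (λ z → (w % a * z) % a) inverse ⟩
    (w % a * 1) % a                  ≡⟨ cong (_% a) (*-identityʳ (w % a)) ⟩
    w % a % a                        ≡⟨ m%n%n≡m%n w a ⟩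
    w % a                            ≡⟨ m<n⇒m%n≡m w<a ⟩
    w                                ∎

module CoprimePair (g₁ g₂ : ℕ → Bool) (a b : ℕ) .{{_ : NonZero a}}
  (gaps₁ : ∀ t → ∃ λ d → d < a × g₁ (t + d) ≡ true)
  (gaps₂ : ∀ t → ∃ λ d → d < b × g₂ (t + d) ≡ true)
  (disjoint : ∀ t → g₁ t ≡ true → g₂ t ≡ true → ⊥)
  (a≤b : a ≤ b) (u : ℕ) (inverse : (u * b) % a ≡ 1) where

  module J₁ = BoundedGaps g₁ a gaps₁
  module J₂ = BoundedGaps g₂ b gaps₂

  no-quiet-window : ∀ x → g₂ x ≡ true → J₂.totalSlack x (a * b) ≡ 0 → J₁.totalSlack x (a * b) ≡ 0 → ⊥
  no-quiet-window x hit₂ quiet₂ quiet₁ with solve-congruence a b u (J₁.wait x) inverse (J₁.wait<p x)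
  ... | j , i , j<a , jb≡w+ia = disjoint (x + j * b) (subst (λ t → g₁ t ≡ true) meet hit₁) hit₂′
    where
    w = J₁.wait x
    jb≤ab : j * b ≤ a * b
    jb≤ab = *-monoˡ-≤ b (<⇒≤ j<a)
    hit₂′ : g₂ (x + j * b) ≡ true
    hit₂′ = J₂.zero-slack-run j x hit₂ (J₂.totalSlack≡0-prefix x (a * b) (j * b) quiet₂ jb≤ab)
    hit₁ : g₁ (x + w + i * a) ≡ true
    hit₁ = J₁.zero-slack-run i (x + w) (J₁.wait-hit x)
      (J₁.totalSlack≡0-suffix x w (i * a)
        (J₁.totalSlack≡0-prefix x (a * b) (w + i * a) quiet₁ (subst (_≤ a * b) jb≡w+ia jb≤ab)))
    meet : x + w + i * a ≡ x + j * b
    meet = trans (+-assoc x w (i * a)) (cong (_+_ x) (sym jb≡w+ia))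

  progress : ∀ x → g₂ x ≡ true → ∃ λ ℓ → 0 < ℓ × ℓ ≤ a * b × g₂ (x + ℓ) ≡ true ×
    ℓ ≤ b * b * J₁.totalSlack x ℓ + a * b * J₂.totalSlack x ℓ
  progress x hit with J₂.totalSlack x (a * b) ≟ 0
  ... | no slack₂ with J₂.slack-witness a x hit (n≢0⇒n>0 slack₂)
  ...   | ℓ , 0<ℓ , ℓ≤ab , hitℓ , slackℓ = ℓ , 0<ℓ , ℓ≤ab , hitℓ ,
          ≤-trans ℓ≤ab (≤-trans (m≤m*n (a * b) _ {{>-nonZero slackℓ}}) (m≤n+m _ _))
  progress x hit | yes quiet₂ with J₁.totalSlack x (a * b) ≟ 0
  ...   | yes quiet₁ = ⊥-elim (no-quiet-window x hit quiet₂ quiet₁)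
  ...   | no slack₁  = a * b , ≤-trans J₁.0<p (m≤m*n a b {{>-nonZero J₂.0<p}}) , ≤-refl ,
          J₂.zero-slack-run a x hit quiet₂ ,
          ≤-trans (*-monoˡ-≤ b a≤b) (≤-trans (m≤m*n (b * b) _ {{≢-nonZero slack₁}}) (m≤m+n _ _))

  weighted-slack-bound : ∀ n x → g₂ x ≡ true →
    n ≤ b * b * J₁.totalSlack x n + a * b * J₂.totalSlack x n + a * b
  weighted-slack-bound n = go n (<-wellFounded n)
    where
    go : ∀ n → Acc _<_ n → ∀ x → g₂ x ≡ true →
      n ≤ b * b * J₁.totalSlack x n + a * b * J₂.totalSlack x n + a * b
    go n (acc rec) x hit with n ≤? a * b
    ... | yes n≤ab = ≤-trans n≤ab (m≤n+m (a * b) _)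
    ... | no n≰ab with progress x hit
    ... | ℓ , 0<ℓ , ℓ≤ab , hitℓ , nearby = begin
      n                                                    ≡⟨ m+[n∸m]≡n ℓ≤n ⟨
      ℓ + r                                                ≤⟨ +-mono-≤ nearby (go r (rec r<n) (x + ℓ) hitℓ) ⟩
      (B * D₁ ℓ + C * D₂ ℓ) + (B * D₁′ + C * D₂′ + C)      ≡⟨ regroup B C (D₁ ℓ) (D₂ ℓ) D₁′ D₂′ ⟩
      B * (D₁ ℓ + D₁′) + C * (D₂ ℓ + D₂′) + C              ≡⟨ cong₂ (λ u v → B * u + C * v + C)
                                                                 (J₁.totalSlack-+ x ℓ r) (J₂.totalSlack-+ x ℓ r) ⟨
      B * D₁ (ℓ + r) + C * D₂ (ℓ + r) + C                  ≡⟨ cong (λ m → B * D₁ m + C * D₂ m + C) (m+[n∸m]≡n ℓ≤n) ⟩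
      B * D₁ n + C * D₂ n + C                              ∎
      where
      open ≤-Reasoning
      B = b * b
      C = a * b
      D₁ = J₁.totalSlack x
      D₂ = J₂.totalSlack x
      r = n ∸ ℓ
      D₁′ = J₁.totalSlack (x + ℓ) r
      D₂′ = J₂.totalSlack (x + ℓ) r
      ℓ≤n : ℓ ≤ n
      ℓ≤n = ≤-trans ℓ≤ab (<⇒≤ (≰⇒> n≰ab))
      r<n : r < n
      r<n = ∸-monoʳ-< 0<ℓ ℓ≤n
      regroup : ∀ B C d₁ d₂ d₁′ d₂′ → (B * d₁ + C * d₂) + (B * d₁′ + C * d₂′ + C) ≡
                                     B * (d₁ + d₁′) + C * (d₂ + d₂′) + C
      regroup = solve-∀

  pair-frequency : ∀ s → g₂ s ≡ true → ∀ N →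
    N * (b * b + a * b + 1) ≤ a * b * b * (count g₁ s N + count g₂ s N) + (a * b * b + a * b * b + a * b)
  pair-frequency s hit N = +-cancelʳ-≤ (b * b * D₁ + a * b * D₂) _ _ (begin
    N * (b * b + a * b + 1) + (b * b * D₁ + a * b * D₂)    ≡⟨ regroup N D₁ D₂ a b ⟩
    b * b * (N + D₁) + a * b * (N + D₂) + N               ≤⟨ +-mono-≤ (+-mono-≤ (*-monoʳ-≤ (b * b) (J₁.count-lower-bound s N))
                                                                                 (*-monoʳ-≤ (a * b) (J₂.count-lower-bound s N)))
                                                                      (weighted-slack-bound N s hit) ⟩
    b * b * (a * c₁ + a) + a * b * (b * c₂ + b) + (b * b * D₁ + a * b * D₂ + a * b)
                                                          ≡⟨ collect D₁ D₂ c₁ c₂ a b ⟩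
    a * b * b * (c₁ + c₂) + (a * b * b + a * b * b + a * b) + (b * b * D₁ + a * b * D₂) ∎)
    where
    open ≤-Reasoning
    c₁ = count g₁ s N
    c₂ = count g₂ s N
    D₁ = J₁.totalSlack s N
    D₂ = J₂.totalSlack s N
    regroup : ∀ N D₁ D₂ a b → N * (b * b + a * b + 1) + (b * b * D₁ + a * b * D₂) ≡
                              b * b * (N + D₁) + a * b * (N + D₂) + N
    regroup = solve-∀
    collect : ∀ D₁ D₂ c₁ c₂ a b →
      b * b * (a * c₁ + a) + a * b * (b * c₂ + b) + (b * b * D₁ + a * b * D₂ + a * b) ≡
      a * b * b * (c₁ + c₂) + (a * b * b + a * b * b + a * b) + (b * b * D₁ + a * b * D₂)
    collect = solve-∀

assigned : ∀ {k} → Schedule k → Fin k → ℕ → Bool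
assigned f i t = does (f t Fin.≟ i)

assigned-disjoint : ∀ {k} (f : Schedule k) {i j} → i ≢ j →
  ∀ t → assigned f i t ≡ true → assigned f j t ≡ true → ⊥
assigned-disjoint f {i} {j} i≢j t hi hj with f t Fin.≟ i | f t Fin.≟ j
... | yes fi | yes fj = i≢j (trans (sym fi) fj)

assigned-gaps : ∀ {k} {A : Fin k → ℕ} (f : Schedule k) → Valid A f →
  ∀ i {p} → A i ≡ p → ∀ t → ∃ λ d → d < p × assigned f i (t + d) ≡ true
assigned-gaps f valid i Ai≡p t with valid i t
... | d , d<Ai , fi = d , subst (d <_) Ai≡p d<Ai , dec-true (_ Fin.≟ i) fi

indicator-sum : ∀ {k} (x : Fin k) → sum (λ i → if does (x Fin.≟ i) then 1 else 0) ≡ 1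
indicator-sum {suc k} zero    = cong suc (sum-replicate-zero k)
indicator-sum         (suc x) = indicator-sum x

count-partition : ∀ {k} (f : Schedule k) s n → sum (λ i → count (assigned f i) s n) ≡ n
count-partition {k} f s zero    = sum-replicate-zero k
count-partition {k} f s (suc n) = begin
  sum (λ i → indicator (assigned f i) s + count (assigned f i) (suc s) n)
    ≡⟨ ∑-distrib-+ (λ i → indicator (assigned f i) s) (λ i → count (assigned f i) (suc s) n) ⟩
  sum (λ i → indicator (assigned f i) s) + sum (λ i → count (assigned f i) (suc s) n)
    ≡⟨ cong₂ _+_ (indicator-sum (f s)) (count-partition f (suc s) n) ⟩
  suc n ∎
  where open ≡-Reasoning

sum-ones : ∀ m → sum {m} (λ _ → 1) ≡ m
sum-ones zero    = refl
sum-ones (suc m) = cong suc (sum-ones m)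

-- suc (∑recip-den B) = ∏ᵢ (1 + B i) and ∑recip-num B = ∑ᵢ ∏_{j ≠ i} (1 + B j).
∑recip-den : ∀ {m} → (Fin m → ℕ) → ℕ
∑recip-den {zero}  B = 0
∑recip-den {suc m} B = ∑recip-den (B ∘ suc) + B zero * suc (∑recip-den (B ∘ suc))

∑recip-num : ∀ {m} → (Fin m → ℕ) → ℕ
∑recip-num {zero}  B = 0
∑recip-num {suc m} B = suc (∑recip-den (B ∘ suc)) + suc (B zero) * ∑recip-num (B ∘ suc)

recipSum-cong : ∀ {k} (A B : Fin k → ℕ) → (∀ i → A i ≡ B i) → recipSum A ≡ recipSum B
recipSum-cong {zero}  A B A≗B = refl
recipSum-cong {suc k} A B A≗B = cong₂ ℚ._+_ (cong recip (A≗B zero)) (recipSum-cong (A ∘ suc) (B ∘ suc) (A≗B ∘ suc))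

recipSum-head-tail : ∀ {m} (A : Fin (suc (suc m)) → ℕ) {a b} {B : Fin m → ℕ} →
  A zero ≡ a → A (suc zero) ≡ b → (∀ i → A (suc (suc i)) ≡ suc (B i)) →
  recipSum A ≡ recip a ℚ.+ (recip b ℚ.+ recipSum (suc ∘ B))
recipSum-head-tail A A₀≡a A₁≡b A≡1+B = cong₂ ℚ._+_ (cong recip A₀≡a)
  (cong₂ ℚ._+_ (cong recip A₁≡b) (recipSum-cong (λ i → A (suc (suc i))) _ A≡1+B))

mkℚᵘ-+ : ∀ n₁ d₁ n₂ d₂ →
  mkℚᵘ (+ n₁) d₁ ℚᵘ.+ mkℚᵘ (+ n₂) d₂ ≡ mkℚᵘ (+ (n₁ * suc d₂ + n₂ * suc d₁)) (d₂ + d₁ * suc d₂)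
mkℚᵘ-+ n₁ d₁ n₂ d₂ = cong (λ n → mkℚᵘ n (d₂ + d₁ * suc d₂)) (sym (begin
  + (n₁ * suc d₂ + n₂ * suc d₁)               ≡⟨ ℤ.pos-+ (n₁ * suc d₂) (n₂ * suc d₁) ⟩
  + (n₁ * suc d₂) ℤ.+ + (n₂ * suc d₁)         ≡⟨ cong₂ ℤ._+_ (ℤ.pos-* n₁ (suc d₂)) (ℤ.pos-* n₂ (suc d₁)) ⟩
  + n₁ ℤ.* + suc d₂ ℤ.+ + n₂ ℤ.* + suc d₁     ∎))
  where open ≡-Reasoning

toℚᵘ-recip-suc : ∀ n → toℚᵘ (recip (suc n)) ≃ mkℚᵘ (+ 1) n
toℚᵘ-recip-suc n = ℚ.toℚᵘ-fromℚᵘ (mkℚᵘ (+ 1) n)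

toℚᵘ-recipSum-suc : ∀ {m} (B : Fin m → ℕ) → toℚᵘ (recipSum (suc ∘ B)) ≃ mkℚᵘ (+ ∑recip-num B) (∑recip-den B)
toℚᵘ-recipSum-suc {zero}  B = ℚᵘ.≃-refl
toℚᵘ-recipSum-suc {suc m} B = begin
  toℚᵘ (recip (suc (B zero)) ℚ.+ recipSum (suc ∘ B ∘ suc))
    ≈⟨ ℚ.toℚᵘ-homo-+ (recip (suc (B zero))) (recipSum (suc ∘ B ∘ suc)) ⟩
  toℚᵘ (recip (suc (B zero))) ℚᵘ.+ toℚᵘ (recipSum (suc ∘ B ∘ suc))
    ≈⟨ ℚᵘ.+-cong (toℚᵘ-recip-suc (B zero)) (toℚᵘ-recipSum-suc (B ∘ suc)) ⟩
  mkℚᵘ (+ 1) (B zero) ℚᵘ.+ mkℚᵘ (+ ∑recip-num (B ∘ suc)) (∑recip-den (B ∘ suc))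
    ≡⟨ mkℚᵘ-+ 1 (B zero) (∑recip-num (B ∘ suc)) (∑recip-den (B ∘ suc)) ⟩
  mkℚᵘ (+ (1 * suc d + n * suc (B zero))) (∑recip-den B)
    ≡⟨ cong (λ x → mkℚᵘ (+ x) (∑recip-den B)) (reorder d (B zero) n) ⟩
  mkℚᵘ (+ ∑recip-num B) (∑recip-den B) ∎
  where
  open ℚᵘ.≃-Reasoning
  d = ∑recip-den (B ∘ suc)
  n = ∑recip-num (B ∘ suc)
  reorder : ∀ d b n → 1 * suc d + n * suc b ≡ suc d + suc b * n
  reorder = solve-∀

1-mkℚᵘ-recip : ∀ q → 1ℚᵘ ℚᵘ.- mkℚᵘ (+ 1) q ≡ mkℚᵘ (+ q) q
1-mkℚᵘ-recip q = cong₂ mkℚᵘ (cong₂ ℤ._+_ (ℤ.*-identityˡ (+ suc q)) (ℤ.*-identityʳ -[1+ 0 ])) (+-identityʳ q)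

toℚᵘ-1-recip : ∀ q → toℚᵘ (1ℚ ℚ.- recip (suc q)) ≃ mkℚᵘ (+ q) q
toℚᵘ-1-recip q = begin
  toℚᵘ (1ℚ ℚ.- recip (suc q))              ≈⟨ ℚ.toℚᵘ-homo-+ 1ℚ (ℚ.- recip (suc q)) ⟩
  1ℚᵘ ℚᵘ.+ toℚᵘ (ℚ.- recip (suc q))        ≈⟨ ℚᵘ.+-congʳ 1ℚᵘ (ℚᵘ.≃-trans (ℚ.toℚᵘ-homo‿- (recip (suc q)))
                                                                       (ℚᵘ.-‿cong (toℚᵘ-recip-suc q))) ⟩
  1ℚᵘ ℚᵘ.- mkℚᵘ (+ 1) q                    ≡⟨ 1-mkℚᵘ-recip q ⟩
  mkℚᵘ (+ q) q                             ∎
  where open ℚᵘ.≃-Reasoning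

toℚᵘ-recip-recip-recipSum : ∀ {m} a′ b′ (B : Fin m → ℕ) →
  let a = suc a′; b = suc b′; d = ∑recip-den B; S = ∑recip-num B in
  toℚᵘ (recip a ℚ.+ (recip b ℚ.+ recipSum (suc ∘ B))) ≃
  mkℚᵘ (+ (1 * (b * suc d) + (1 * suc d + S * b) * a)) (pred (a * (b * suc d)))
toℚᵘ-recip-recip-recipSum a′ b′ B = begin
  toℚᵘ (recip a ℚ.+ (recip b ℚ.+ recipSum (suc ∘ B)))
    ≈⟨ ℚᵘ.≃-trans (ℚ.toℚᵘ-homo-+ (recip a) _) (ℚᵘ.+-cong (toℚᵘ-recip-suc a′) (ℚ.toℚᵘ-homo-+ (recip b) _)) ⟩
  mkℚᵘ (+ 1) a′ ℚᵘ.+ (toℚᵘ (recip b) ℚᵘ.+ toℚᵘ (recipSum (suc ∘ B)))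
    ≈⟨ ℚᵘ.+-congʳ (mkℚᵘ (+ 1) a′) (ℚᵘ.+-cong (toℚᵘ-recip-suc b′) (toℚᵘ-recipSum-suc B)) ⟩
  mkℚᵘ (+ 1) a′ ℚᵘ.+ (mkℚᵘ (+ 1) b′ ℚᵘ.+ mkℚᵘ (+ S) d)
    ≡⟨ cong (mkℚᵘ (+ 1) a′ ℚᵘ.+_) (mkℚᵘ-+ 1 b′ S d) ⟩
  mkℚᵘ (+ 1) a′ ℚᵘ.+ mkℚᵘ (+ (1 * suc d + S * b)) (pred (b * suc d))
    ≡⟨ mkℚᵘ-+ 1 a′ (1 * suc d + S * b) (pred (b * suc d)) ⟩
  mkℚᵘ (+ (1 * (b * suc d) + (1 * suc d + S * b) * a)) (pred (a * (b * suc d))) ∎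
  where
  open ℚᵘ.≃-Reasoning
  a = suc a′
  b = suc b′
  d = ∑recip-den B
  S = ∑recip-num B

density-inequality : ∀ {m} a′ b′ (B : Fin m → ℕ) →
  let a = suc a′; b = suc b′; P = suc (∑recip-den B); S = ∑recip-num B in
  recip a ℚ.+ (recip b ℚ.+ recipSum (suc ∘ B)) ℚ.> 1ℚ ℚ.- recip (a * b * b) →
  a * b * b * P < b * b * P + a * b * P + a * b * b * S + P
density-inequality a′ b′ B dense = *-cancelˡ-< (a * b) _ _ (begin-strict
  a * b * (Q * P)                       ≡⟨ regroup a b P ⟩
  Q * X                                 ≡⟨⟩
  X + q * X                             <⟨ +-monoʳ-< X cross ⟩
  X + Y * Q                             ≡⟨ collect a b P S ⟩
  a * b * (b * b * P + a * b * P + Q * S + P) ∎)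
  where
  open ≤-Reasoning
  a = suc a′
  b = suc b′
  P = suc (∑recip-den B)
  S = ∑recip-num B
  Q = a * b * b
  q = pred Q
  X = a * (b * P)
  Y = 1 * (b * P) + (1 * P + S * b) * a
  cross : q * X < Y * Q
  cross with ℚᵘ.<-respʳ-≃ (toℚᵘ-recip-recip-recipSum a′ b′ B) (ℚᵘ.<-respˡ-≃ (toℚᵘ-1-recip q) (ℚ.toℚᵘ-mono-< dense))
  ... | *<* lt = ℤ.drop‿+<+ (subst₂ ℤ._<_ (sym (ℤ.pos-* q X)) (sym (ℤ.pos-* Y Q)) lt)
  regroup : ∀ a b P → a * b * (a * b * b * P) ≡ a * b * b * (a * (b * P))
  regroup = solve-∀
  collect : ∀ a b P S → a * (b * P) + (1 * (b * P) + (1 * P + S * b) * a) * (a * b * b) ≡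
                        a * b * (b * b * P + a * b * P + a * b * b * S + P)
  collect = solve-∀

∑recip-num-bound : ∀ {m} (B x : Fin m → ℕ) K →
  (∀ i → K * suc (∑recip-den B) ≤ suc (B i) * x i) → K * ∑recip-num B ≤ sum x
∑recip-num-bound {zero}  B x K _     = ≤-reflexive (*-zeroʳ K)
∑recip-num-bound {suc m} B x K bound = begin
  K * (suc d + suc b * ∑recip-num (B ∘ suc))        ≡⟨ distrib K d b (∑recip-num (B ∘ suc)) ⟩
  K * suc d + K * suc b * ∑recip-num (B ∘ suc)      ≤⟨ +-mono-≤ head (∑recip-num-bound (B ∘ suc) (x ∘ suc) (K * suc b) tail) ⟩
  x zero + sum (x ∘ suc)                            ∎
  where
  open ≤-Reasoning
  b = B zero
  d = ∑recip-den (B ∘ suc)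
  distrib : ∀ K d b n → K * (suc d + suc b * n) ≡ K * suc d + K * suc b * n
  distrib = solve-∀
  swap : ∀ K b d → K * (suc b * suc d) ≡ suc b * (K * suc d)
  swap = solve-∀
  head : K * suc d ≤ x zero
  head = *-cancelˡ-≤ (suc b) (subst (_≤ suc b * x zero) (swap K b d) (bound zero))
  tail : ∀ i → K * suc b * suc d ≤ suc (B (suc i)) * x (suc i)
  tail i = subst (_≤ suc (B (suc i)) * x (suc i)) (sym (*-assoc K (suc b) (suc d))) (bound (suc i))

frequency-lower-bound : ∀ {m} (B : Fin m → ℕ) (g : Fin m → ℕ → Bool) →
  (∀ i t → ∃ λ d → d < suc (B i) × g i (t + d) ≡ true) →
  ∀ s K → K * ∑recip-num B ≤ sum (λ i → count (g i) s (K * suc (∑recip-den B))) + m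
frequency-lower-bound {m} B g gaps s K = begin
  K * ∑recip-num B          ≤⟨ ∑recip-num-bound B (λ i → c i + 1) K per-job ⟩
  sum (λ i → c i + 1)       ≡⟨ ∑-distrib-+ c (λ _ → 1) ⟩
  sum c + sum {m} (λ _ → 1) ≡⟨ cong (_+_ (sum c)) (sum-ones m) ⟩
  sum c + m                 ∎
  where
  open ≤-Reasoning
  N = K * suc (∑recip-den B)
  c : Fin m → ℕ
  c i = count (g i) s N
  per-job : ∀ i → N ≤ suc (B i) * (c i + 1)
  per-job i = begin
    N                                ≤⟨ m≤m+n N _ ⟩
    N + _                            ≤⟨ BoundedGaps.count-lower-bound (g i) (suc (B i)) (gaps i) s N ⟩
    suc (B i) * c i + suc (B i)      ≡⟨ cong (_+_ (suc (B i) * c i)) (*-identityʳ (suc (B i))) ⟨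
    suc (B i) * c i + suc (B i) * 1  ≡⟨ *-distribˡ-+ (suc (B i)) (c i) 1 ⟨
    suc (B i) * (c i + 1)            ∎

multiplier-bound : ∀ a b P S m c₁ c₂ T K C →
  a * b * b * P < b * b * P + a * b * P + a * b * b * S + P →
  K * (a * b) * P ≡ c₁ + (c₂ + T) →
  K * (a * b) * P * (b * b + a * b + 1) ≤ a * b * b * (c₁ + c₂) + C →
  K * (a * b) * S ≤ T + m →
  K * (a * b) ≤ a * b * b * m + C
multiplier-bound a b P S m c₁ c₂ T K C density total pair tail = +-cancelˡ-≤ (Q * N) _ _ (begin
  Q * N + K * (a * b)                                   ≡⟨ regroup a b P K ⟩
  K * (a * b) * suc (Q * P)                             ≤⟨ *-monoʳ-≤ (K * (a * b)) density ⟩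
  K * (a * b) * (b * b * P + a * b * P + Q * S + P)     ≡⟨ expand a b P S K ⟩
  N * (b * b + a * b + 1) + Q * (K * (a * b) * S)       ≤⟨ +-mono-≤ pair (*-monoʳ-≤ Q tail) ⟩
  Q * (c₁ + c₂) + C + Q * (T + m)                       ≡⟨ collect Q c₁ c₂ C T m ⟩
  Q * (c₁ + (c₂ + T)) + (Q * m + C)                     ≡⟨ cong (λ n → Q * n + (Q * m + C)) total ⟨
  Q * N + (Q * m + C)                                   ∎)
  where
  open ≤-Reasoning
  Q = a * b * b
  N = K * (a * b) * P
  regroup : ∀ a b P K → a * b * b * (K * (a * b) * P) + K * (a * b) ≡ K * (a * b) * suc (a * b * b * P)
  regroup = solve-∀
  expand : ∀ a b P S K → K * (a * b) * (b * b * P + a * b * P + a * b * b * S + P) ≡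
                         K * (a * b) * P * (b * b + a * b + 1) + a * b * b * (K * (a * b) * S)
  expand = solve-∀
  collect : ∀ Q c₁ c₂ C T m → Q * (c₁ + c₂) + C + Q * (T + m) ≡ Q * (c₁ + (c₂ + T)) + (Q * m + C)
  collect = solve-∀

lemma5p1 : (a b m : ℕ) → 1 < a → a < b → gcd a b ≡ 1
    → (A : Fin (suc (suc m)) → ℕ)
    → (∀ i → 1 ≤ A i)
    → (∀ i j → toℕ i ≤ toℕ j → A i ≤ A j)
    → A zero ≡ a → A (suc zero) ≡ b
    → recipSum A > 1ℚ - recip (a * b * b)
    → ¬ Schedulable A
lemma5p1 a@(suc a′) b@(suc b′) m 1<a a<b gcd≡1 A pos _ A₀≡a A₁≡b dense (f , valid)
  with assigned-gaps f valid (suc zero) refl 0 | mod-inverse a b 1<a (gcd≡1⇒coprime gcd≡1)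
... | s , _ , s-hit | u , inverse =
  <-irrefl refl (≤-trans (m≤m*n M (a * b)) (multiplier-bound a b P S m c₀ c₁ T M C density partition pair tail))
  where
  open CoprimePair (assigned f zero) (assigned f (suc zero)) a b
    (assigned-gaps f valid zero A₀≡a) (assigned-gaps f valid (suc zero) A₁≡b)
    (assigned-disjoint f λ ()) (<⇒≤ a<b) u inverse
  B : Fin m → ℕ
  B i = pred (A (suc (suc i)))
  A≡1+B : ∀ i → A (suc (suc i)) ≡ suc (B i)
  A≡1+B i = sym (suc-pred (A (suc (suc i))) {{>-nonZero (pos (suc (suc i)))}})
  P = suc (∑recip-den B)
  S = ∑recip-num B
  C = a * b * b + a * b * b + a * b
  M = suc (a * b * b * m + C)
  N = M * (a * b) * P
  c₀ = count (assigned f zero) s N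
  c₁ = count (assigned f (suc zero)) s N
  T = sum (λ i → count (assigned f (suc (suc i))) s N)
  density : a * b * b * P < b * b * P + a * b * P + a * b * b * S + P
  density = density-inequality a′ b′ B (subst (_> 1ℚ - recip (a * b * b)) (recipSum-head-tail A A₀≡a A₁≡b A≡1+B) dense)
  partition : N ≡ c₀ + (c₁ + T)
  partition = sym (count-partition f s N)
  pair : N * (b * b + a * b + 1) ≤ a * b * b * (c₀ + c₁) + C
  pair = pair-frequency s s-hit N
  tail : M * (a * b) * S ≤ T + m
  tail = frequency-lower-bound B (λ i → assigned f (suc (suc i)))
    (λ i → assigned-gaps f valid (suc (suc i)) (A≡1+B i)) s (M * (a * b))
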